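{- Let $\alpha$ be an ordinal of finite degree with Cantor normal form $\alpha=a_n\omega^n+a_{n-1}\omega^{n-1}+\cdots+a_1\omega+a_0$ ($a_n\neq 0$). Then $\omega\cdot_F\alpha=\omega^n$, i.e. $\omega\cdot_F\alpha=\omega^{\deg(\alpha)}$.
   Context: Products $LM$ of linear orders are lexicographic: $L\times M$ ordered by $(l,m)<(l',m')$ iff $l<l'$ or ($l=l'$ and $m<m'$), i.e. each point of $L$ replaced by a copy of $M$; so $a\omega^k$ is $a$ copies of $\omega^k$. For a linear order $L$, $x\sim_F y$ iff only finitely many points lie between $x$ and $y$; $L/\!\sim_F$ is the ordered set of classes. $L\cdot_F M$ is the order type of $(LM)/\!\sim_F$. The degree of $\alpha$ is the largest exponent $n$ in its Cantor normal form. -}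

module Defs where

open import Data.Nat using (ℕ; zero; suc)
open import Data.Fin using (Fin; fromℕ; inject₁)
open import Data.Product using (_×_; _,_; Σ; ∃)
open import Data.Sum using (_⊎_; inj₁; inj₂)
open import Data.Unit using (⊤; tt)
open import Data.Empty using (⊥)
open import Data.List using (List)
open import Data.List.Membership.Propositional using (_∈_)
open import Relation.Binary.PropositionalEquality using (_≡_)
open import Relation.Nullary using (¬_)
open import Function.Bundles using (_⇔_)
import Data.Nat as N
import Data.Fin as F

record LinOrd : Set₁ where
  field
    Carrier : Set
    _<_     : Carrier → Carrier → Set

open LinOrd public

ωOrd : LinOrd
ωOrd = record { Carrier = ℕ ; _<_ = N._<_ }

finOrd : ℕ → LinOrd
finOrd c = record { Carrier = Fin c ; _<_ = F._<_ }

-- lexicographic product L M : each point of L replaced by a copy of M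
_⊗_ : LinOrd → LinOrd → LinOrd
L ⊗ M = record
  { Carrier = Carrier L × Carrier M
  ; _<_ = λ { (l , m) (l' , m') → _<_ L l l' ⊎ (l ≡ l' × _<_ M m m') } }

_⊕_ : LinOrd → LinOrd → LinOrd
L ⊕ M = record
  { Carrier = Carrier L ⊎ Carrier M
  ; _<_ = lt }
  where
  lt : Carrier L ⊎ Carrier M → Carrier L ⊎ Carrier M → Set
  lt (inj₁ x) (inj₁ y) = _<_ L x y
  lt (inj₁ x) (inj₂ y) = ⊤
  lt (inj₂ x) (inj₁ y) = ⊥
  lt (inj₂ x) (inj₂ y) = _<_ M x y

ωpow : ℕ → LinOrd
ωpow zero    = finOrd 1
ωpow (suc k) = ωOrd ⊗ ωpow k

term : ℕ → ℕ → LinOrd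
term k c = finOrd c ⊗ ωpow k

-- the ordinal a_n ω^n + a_{n-1} ω^{n-1} + ... + a_1 ω + a_0,
-- coefficients given by a : Fin (suc n) → ℕ (a i = coefficient of ω^i)
cnf : (n : ℕ) → (Fin (suc n) → ℕ) → LinOrd
cnf zero    a = term zero (a Fin.zero)
cnf (suc n) a = term (suc n) (a (fromℕ (suc n))) ⊕ cnf n (λ i → a (inject₁ i))

Between : (L : LinOrd) → Carrier L → Carrier L → Carrier L → Set
Between L x y z = (_<_ L x z × _<_ L z y) ⊎ (_<_ L y z × _<_ L z x)

∼F : (L : LinOrd) → Carrier L → Carrier L → Set
∼F L x y = ∃ λ (l : List (Carrier L)) → ∀ z → Between L x y z → z ∈ l

-- The order type of L / ∼F is M: there is a map f : L → M that is
-- surjective, whose kernel is exactly ∼F, and such that the induced order on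
-- classes ([x] < [y] iff x < y and x ≁F y) is the order of M; i.e. f induces
-- an order isomorphism L/∼F ≅ M.
CondensationIs : LinOrd → LinOrd → Set
CondensationIs L M =
  Σ (Carrier L → Carrier M) λ f →
      (∀ m → ∃ λ x → f x ≡ m)
    × (∀ x y → (f x ≡ f y) ⇔ ∼F L x y)
    × (∀ x y → _<_ M (f x) (f y) ⇔ (_<_ L x y × ¬ ∼F L x y))

-- In the notation of the paper, ω ⊗ α is the ordinal α·ω, and for
-- α = c·ωⁿ + β with c ≥ 1 and β < ωⁿ we have β + c·ωⁿ = c·ωⁿ, so
--   α·ω = c·ωⁿ + (β + c·ωⁿ)·ω = c·ωⁿ + (c·ωⁿ)·ω = (c·ωⁿ)·ω = ωⁿ·ω,
-- i.e. ω ⊗ α ≅ ωⁿ ⊗ ω: ωⁿ copies of ω. Condensing M ⊗ ω collapses each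
-- copy of ω to a point, since two points in the same copy have finitely
-- many points between them and two points in different copies have a whole
-- tail of a copy of ω between them; hence it yields M = ωⁿ.
module Submission where

open import Defs
open import Data.Nat using (ℕ; suc)
open import Data.Fin using (Fin; fromℕ)
open import Relation.Binary.PropositionalEquality using (_≢_)

open import Data.Nat as ℕ using (zero; z≤n; s≤s; _+_; _*_)
import Data.Nat.Properties as ℕ
open import Data.Nat.DivMod using (_/_; m≡m%n+[m/n]*n; m%n<n)
import Data.Fin as F
import Data.Fin.Properties as F
open import Data.Product using (_×_; _,_; proj₁; proj₂)
import Data.Product as Product
open import Data.Product.Relation.Binary.Lex.Strict using (×-compare)
open import Data.Product.Relation.Binary.Pointwise.NonDependent using (≡×≡⇒≡; ≡⇒≡×≡)
open import Data.Product.Function.NonDependent.Propositional using (_×-⇔_)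
open import Data.Sum using (inj₁; inj₂)
import Data.Sum as Sum
open import Data.Sum.Properties using (inj₁-injective; inj₂-injective)
open import Data.Unit using (tt)
open import Data.Empty using (⊥-elim)
open import Data.List using (List; map; applyUpTo)
open import Data.List.Extrema.Nat using (max; xs≤max)
import Data.List.Relation.Unary.All as All
open import Data.List.Membership.Propositional using (_∈_)
open import Data.List.Membership.Propositional.Properties using (∈-map⁺; ∈-applyUpTo⁺)
open import Relation.Binary.PropositionalEquality
  using (_≡_; refl; sym; trans; cong; cong₂; subst; subst₂)
open import Relation.Binary.Definitions using (Trichotomous; Tri; tri<; tri≈; tri>)
open import Relation.Binary.Consequences using (tri⇒irr; tri⇒asym)
open import Relation.Nullary using (¬_)
open import Function using (_∘_)
open import Function.Bundles using (_⇔_; mk⇔)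
import Function.Properties.Equivalence as ⇔
open import Function.Related.TypeIsomorphisms using (¬-cong-⇔)

lt : (L : LinOrd) → Carrier L → Carrier L → Set
lt = _<_

syntax lt L x y = x <[ L ] y

record Total (L : LinOrd) : Set where
  field compare : Trichotomous _≡_ (lt L)

open Total {{...}}

module _ (L : LinOrd) {{_ : Total L}} where

  <-irrefl : ∀ {x} → ¬ x <[ L ] x
  <-irrefl = tri⇒irr compare refl

  <-asym : ∀ {x y} → x <[ L ] y → ¬ y <[ L ] x
  <-asym = tri⇒asym compare

Tri-map-≈ : ∀ {A B B′ C : Set} → (B → B′) → (B′ → B) → Tri A B C → Tri A B′ C
Tri-map-≈ f g (tri< a ¬b ¬c) = tri< a (¬b ∘ g) ¬c
Tri-map-≈ f g (tri≈ ¬a b ¬c) = tri≈ ¬a (f b) ¬c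
Tri-map-≈ f g (tri> ¬a ¬b c) = tri> ¬a (¬b ∘ g) c

instance
  ω-total : Total ωOrd
  ω-total = record { compare = ℕ.<-cmp }

  finOrd-total : ∀ {c} → Total (finOrd c)
  finOrd-total = record { compare = F.<-cmp }

  ⊗-total : ∀ {A B} → {{Total A}} → {{Total B}} → Total (A ⊗ B)
  ⊗-total {{tA}} {{tB}} = record { compare = λ x y →
    Tri-map-≈ ≡×≡⇒≡ ≡⇒≡×≡ (×-compare sym (Total.compare tA) (Total.compare tB) x y) }

  ⊕-total : ∀ {A B} → {{Total A}} → {{Total B}} → Total (A ⊕ B)
  ⊕-total {A} {B} {{tA}} {{tB}} = record { compare = cmp }
    where
    cmp : Trichotomous _≡_ (lt (A ⊕ B))
    cmp (inj₁ x) (inj₁ y) = Tri-map-≈ (cong inj₁) inj₁-injective (Total.compare tA x y)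
    cmp (inj₁ x) (inj₂ y) = tri< tt (λ ()) (λ ())
    cmp (inj₂ x) (inj₁ y) = tri> (λ ()) (λ ()) tt
    cmp (inj₂ x) (inj₂ y) = Tri-map-≈ (cong inj₂) inj₂-injective (Total.compare tB x y)

-- Not instances: instance search cannot solve ωpow ?n = ωpow n.
ωpow-total : ∀ n → Total (ωpow n)
ωpow-total zero    = finOrd-total
ωpow-total (suc n) = ⊗-total {{ω-total}} {{ωpow-total n}}

cnf-total : ∀ n a → Total (cnf n a)
cnf-total zero    a = ⊗-total
cnf-total (suc n) a = ⊕-total {{⊗-total {{finOrd-total}} {{ωpow-total (suc n)}}}} {{cnf-total n _}}

-- Order isomorphisms

StrictlyMonotone : (L M : LinOrd) → (Carrier L → Carrier M) → Set
StrictlyMonotone L M f = ∀ x y → x <[ L ] y → f x <[ M ] f y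

record _≃_ (L M : LinOrd) : Set where
  field
    to        : Carrier L → Carrier M
    from      : Carrier M → Carrier L
    from∘to   : ∀ x → from (to x) ≡ x
    to∘from   : ∀ y → to (from y) ≡ y
    to-mono   : StrictlyMonotone L M to
    from-mono : StrictlyMonotone M L from

open _≃_

infix 4 _≃_

-- A strictly monotone map between total orders is injective and reflects
-- the order, so a right inverse is all that is missing for an isomorphism.
strictMono⇒≃ : ∀ {L M} {{_ : Total L}} {{_ : Total M}}
  (t : Carrier L → Carrier M) (f : Carrier M → Carrier L) →
  (∀ y → t (f y) ≡ y) → StrictlyMonotone L M t → L ≃ M
strictMono⇒≃ {L} {M} t f t∘f mono = record
  { to = t ; from = f ; from∘to = f∘t ; to∘from = t∘f
  ; to-mono = mono ; from-mono = f-mono }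
  where
  f∘t : ∀ x → f (t x) ≡ x
  f∘t x with compare (f (t x)) x
  ... | tri< p _ _ = ⊥-elim (<-irrefl M (subst₂ (lt M) (t∘f (t x)) refl (mono _ _ p)))
  ... | tri≈ _ e _ = e
  ... | tri> _ _ p = ⊥-elim (<-irrefl M (subst₂ (lt M) refl (t∘f (t x)) (mono _ _ p)))

  f-mono : StrictlyMonotone M L f
  f-mono x y p with compare (f x) (f y)
  ... | tri< q _ _ = q
  ... | tri≈ _ e _ =
    ⊥-elim (<-irrefl M (subst (lt M x) (trans (sym (t∘f y)) (trans (cong t (sym e)) (t∘f x))) p))
  ... | tri> _ _ q = ⊥-elim (<-asym M p (subst₂ (lt M) (t∘f y) (t∘f x) (mono _ _ q)))

≃-refl : ∀ {L} → L ≃ L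
≃-refl = record
  { to = λ x → x ; from = λ x → x ; from∘to = λ _ → refl ; to∘from = λ _ → refl
  ; to-mono = λ _ _ p → p ; from-mono = λ _ _ p → p }

≃-sym : ∀ {L M} → L ≃ M → M ≃ L
≃-sym φ = record
  { to = from φ ; from = to φ ; from∘to = to∘from φ ; to∘from = from∘to φ
  ; to-mono = from-mono φ ; from-mono = to-mono φ }

≃-trans : ∀ {L M K} → L ≃ M → M ≃ K → L ≃ K
≃-trans φ ψ = record
  { to = to ψ ∘ to φ ; from = from φ ∘ from ψ
  ; from∘to = λ x → trans (cong (from φ) (from∘to ψ (to φ x))) (from∘to φ x)
  ; to∘from = λ z → trans (cong (to ψ) (to∘from φ (from ψ z))) (to∘from ψ z)
  ; to-mono = λ x y → to-mono ψ _ _ ∘ to-mono φ x y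
  ; from-mono = λ x y → from-mono φ _ _ ∘ from-mono ψ x y }

module ≃-Reasoning where
  open import Relation.Binary.Reasoning.Base.Single _≃_ ≃-refl ≃-trans public
    using (begin_; _∎; _IsRelatedTo_; ∼-go)
  open import Relation.Binary.Reasoning.Syntax using (module ≃-syntax)
  open ≃-syntax _IsRelatedTo_ _IsRelatedTo_ ∼-go ≃-sym public

⊗-map-mono : ∀ {A A′ B B′} {f : Carrier A → Carrier A′} {g : Carrier B → Carrier B′} →
  StrictlyMonotone A A′ f → StrictlyMonotone B B′ g →
  StrictlyMonotone (A ⊗ B) (A′ ⊗ B′) (Product.map f g)
⊗-map-mono f-mono g-mono _ _ (inj₁ p) = inj₁ (f-mono _ _ p)
⊗-map-mono {f = f} f-mono g-mono _ _ (inj₂ (e , q)) = inj₂ (cong f e , g-mono _ _ q)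

⊕-map-mono : ∀ {A A′ B B′} {f : Carrier A → Carrier A′} {g : Carrier B → Carrier B′} →
  StrictlyMonotone A A′ f → StrictlyMonotone B B′ g →
  StrictlyMonotone (A ⊕ B) (A′ ⊕ B′) (Sum.map f g)
⊕-map-mono f-mono g-mono (inj₁ _) (inj₁ _) p = f-mono _ _ p
⊕-map-mono f-mono g-mono (inj₁ _) (inj₂ _) p = tt
⊕-map-mono f-mono g-mono (inj₂ _) (inj₂ _) p = g-mono _ _ p

⊗-cong : ∀ {A A′ B B′} → A ≃ A′ → B ≃ B′ → A ⊗ B ≃ A′ ⊗ B′
⊗-cong {A} {A′} {B} {B′} φ ψ = record
  { to = Product.map (to φ) (to ψ) ; from = Product.map (from φ) (from ψ)
  ; from∘to = λ (a , b) → cong₂ _,_ (from∘to φ a) (from∘to ψ b)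
  ; to∘from = λ (a , b) → cong₂ _,_ (to∘from φ a) (to∘from ψ b)
  ; to-mono = ⊗-map-mono {A} {A′} {B} {B′} (to-mono φ) (to-mono ψ)
  ; from-mono = ⊗-map-mono {A′} {A} {B′} {B} (from-mono φ) (from-mono ψ) }

⊕-cong : ∀ {A A′ B B′} → A ≃ A′ → B ≃ B′ → A ⊕ B ≃ A′ ⊕ B′
⊕-cong {A} {A′} {B} {B′} φ ψ = record
  { to = Sum.map (to φ) (to ψ) ; from = Sum.map (from φ) (from ψ)
  ; from∘to = λ { (inj₁ a) → cong inj₁ (from∘to φ a) ; (inj₂ b) → cong inj₂ (from∘to ψ b) }
  ; to∘from = λ { (inj₁ a) → cong inj₁ (to∘from φ a) ; (inj₂ b) → cong inj₂ (to∘from ψ b) }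
  ; to-mono = ⊕-map-mono {A} {A′} {B} {B′} (to-mono φ) (to-mono ψ)
  ; from-mono = ⊕-map-mono {A′} {A} {B′} {B} (from-mono φ) (from-mono ψ) }

module _ {A B C : LinOrd} {{_ : Total A}} {{_ : Total B}} {{_ : Total C}} where

  ⊕-assoc : (A ⊕ B) ⊕ C ≃ A ⊕ (B ⊕ C)
  ⊕-assoc = strictMono⇒≃ t f f-inverse mono
    where
    t : Carrier ((A ⊕ B) ⊕ C) → Carrier (A ⊕ (B ⊕ C))
    t (inj₁ (inj₁ a)) = inj₁ a
    t (inj₁ (inj₂ b)) = inj₂ (inj₁ b)
    t (inj₂ c)        = inj₂ (inj₂ c)

    f : Carrier (A ⊕ (B ⊕ C)) → Carrier ((A ⊕ B) ⊕ C)
    f (inj₁ a)        = inj₁ (inj₁ a)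
    f (inj₂ (inj₁ b)) = inj₁ (inj₂ b)
    f (inj₂ (inj₂ c)) = inj₂ c

    f-inverse : ∀ y → t (f y) ≡ y
    f-inverse (inj₁ a)        = refl
    f-inverse (inj₂ (inj₁ b)) = refl
    f-inverse (inj₂ (inj₂ c)) = refl

    mono : StrictlyMonotone ((A ⊕ B) ⊕ C) (A ⊕ (B ⊕ C)) t
    mono (inj₁ (inj₁ _)) (inj₁ (inj₁ _)) p = p
    mono (inj₁ (inj₁ _)) (inj₁ (inj₂ _)) p = tt
    mono (inj₁ (inj₁ _)) (inj₂ _)        p = tt
    mono (inj₁ (inj₂ _)) (inj₁ (inj₂ _)) p = p
    mono (inj₁ (inj₂ _)) (inj₂ _)        p = tt
    mono (inj₂ _)        (inj₂ _)        p = p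

  ⊗-assoc : (A ⊗ B) ⊗ C ≃ A ⊗ (B ⊗ C)
  ⊗-assoc = strictMono⇒≃ (λ ((a , b) , c) → a , (b , c)) (λ (a , (b , c)) → (a , b) , c)
    (λ _ → refl) mono
    where
    mono : StrictlyMonotone ((A ⊗ B) ⊗ C) (A ⊗ (B ⊗ C)) _
    mono _ _ (inj₁ (inj₁ p))       = inj₁ p
    mono _ _ (inj₁ (inj₂ (e , q))) = inj₂ (e , inj₁ q)
    mono _ _ (inj₂ (refl , q))     = inj₂ (refl , inj₂ (refl , q))

module _ {Y : LinOrd} {{_ : Total Y}} where

  finOrd1-⊗-identityˡ : finOrd 1 ⊗ Y ≃ Y
  finOrd1-⊗-identityˡ = strictMono⇒≃ proj₂ (F.zero ,_) (λ _ → refl) mono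
    where
    mono : StrictlyMonotone (finOrd 1 ⊗ Y) Y proj₂
    mono (F.zero , _) (F.zero , _) (inj₂ (_ , q)) = q

  finOrd-suc-⊗ : ∀ k → finOrd (suc k) ⊗ Y ≃ Y ⊕ (finOrd k ⊗ Y)
  finOrd-suc-⊗ k = strictMono⇒≃ t f f-inverse mono
    where
    t : Carrier (finOrd (suc k) ⊗ Y) → Carrier (Y ⊕ (finOrd k ⊗ Y))
    t (F.zero , y)  = inj₁ y
    t (F.suc j , y) = inj₂ (j , y)

    f : Carrier (Y ⊕ (finOrd k ⊗ Y)) → Carrier (finOrd (suc k) ⊗ Y)
    f (inj₁ y)       = F.zero , y
    f (inj₂ (j , y)) = F.suc j , y

    f-inverse : ∀ y → t (f y) ≡ y
    f-inverse (inj₁ y)       = refl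
    f-inverse (inj₂ (j , y)) = refl

    mono : StrictlyMonotone (finOrd (suc k) ⊗ Y) (Y ⊕ (finOrd k ⊗ Y)) t
    mono (F.zero , _)  (F.zero , _)  (inj₂ (_ , q))    = q
    mono (F.zero , _)  (F.suc _ , _) p                 = tt
    mono (F.suc _ , _) (F.suc _ , _) (inj₁ (s≤s p))    = inj₁ p
    mono (F.suc _ , _) (F.suc _ , _) (inj₂ (refl , q)) = inj₂ (refl , q)

  ω⊗-unfold : Y ⊕ (ωOrd ⊗ Y) ≃ ωOrd ⊗ Y
  ω⊗-unfold = strictMono⇒≃ t f f-inverse mono
    where
    t : Carrier (Y ⊕ (ωOrd ⊗ Y)) → Carrier (ωOrd ⊗ Y)
    t (inj₁ y)       = 0 , y
    t (inj₂ (i , y)) = suc i , y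

    f : Carrier (ωOrd ⊗ Y) → Carrier (Y ⊕ (ωOrd ⊗ Y))
    f (zero , y)  = inj₁ y
    f (suc i , y) = inj₂ (i , y)

    f-inverse : ∀ y → t (f y) ≡ y
    f-inverse (zero , y)  = refl
    f-inverse (suc i , y) = refl

    mono : StrictlyMonotone (Y ⊕ (ωOrd ⊗ Y)) (ωOrd ⊗ Y) t
    mono (inj₁ _) (inj₁ _) q                 = inj₂ (refl , q)
    mono (inj₁ _) (inj₂ _) _                 = inj₁ (s≤s z≤n)
    mono (inj₂ _) (inj₂ _) (inj₁ p)          = inj₁ (s≤s p)
    mono (inj₂ _) (inj₂ _) (inj₂ (refl , q)) = inj₂ (refl , q)

  finOrd0-⊗-⊕-identityˡ : ∀ {Z} {{_ : Total Z}} → (finOrd 0 ⊗ Y) ⊕ Z ≃ Z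
  finOrd0-⊗-⊕-identityˡ {Z} = strictMono⇒≃ t inj₂ (λ _ → refl) mono
    where
    t : Carrier ((finOrd 0 ⊗ Y) ⊕ Z) → Carrier Z
    t (inj₂ z) = z

    mono : StrictlyMonotone ((finOrd 0 ⊗ Y) ⊕ Z) Z t
    mono (inj₂ _) (inj₂ _) p = p

-- (A + B)·ω = A + (B + A)·ω: regroup the copies of A ⊕ B, shifting by one A.
ω⊗-⊕-rotate : ∀ {A B} {{_ : Total A}} {{_ : Total B}} →
  ωOrd ⊗ (A ⊕ B) ≃ A ⊕ (ωOrd ⊗ (B ⊕ A))
ω⊗-⊕-rotate {A} {B} = strictMono⇒≃ t f f-inverse mono
  where
  t : Carrier (ωOrd ⊗ (A ⊕ B)) → Carrier (A ⊕ (ωOrd ⊗ (B ⊕ A)))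
  t (i , inj₂ b)     = inj₂ (i , inj₁ b)
  t (zero , inj₁ a)  = inj₁ a
  t (suc i , inj₁ a) = inj₂ (i , inj₂ a)

  f : Carrier (A ⊕ (ωOrd ⊗ (B ⊕ A))) → Carrier (ωOrd ⊗ (A ⊕ B))
  f (inj₁ a)            = zero , inj₁ a
  f (inj₂ (i , inj₁ b)) = i , inj₂ b
  f (inj₂ (i , inj₂ a)) = suc i , inj₁ a

  f-inverse : ∀ y → t (f y) ≡ y
  f-inverse (inj₁ a)            = refl
  f-inverse (inj₂ (i , inj₁ b)) = refl
  f-inverse (inj₂ (i , inj₂ a)) = refl

  mono : StrictlyMonotone (ωOrd ⊗ (A ⊕ B)) (A ⊕ (ωOrd ⊗ (B ⊕ A))) t
  mono (zero , inj₁ _)  (zero , inj₁ _)  (inj₂ (_ , q))    = q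
  mono (zero , inj₁ _)  (_ , inj₂ _)     _                 = tt
  mono (zero , inj₁ _)  (suc _ , inj₁ _) _                 = tt
  mono (_ , inj₂ _)     (zero , inj₁ _)  (inj₂ (_ , ()))
  mono (_ , inj₂ _)     (_ , inj₂ _)     p                 = p
  mono (_ , inj₂ _)     (suc _ , inj₁ _) (inj₁ (s≤s i≤j)) with ℕ.m≤n⇒m<n∨m≡n i≤j
  ... | inj₁ i<j = inj₁ i<j
  ... | inj₂ i≡j = inj₂ (i≡j , tt)
  mono (suc i , inj₁ _) (_ , inj₂ _)     (inj₁ p)          = inj₁ (ℕ.<-trans (ℕ.n<1+n i) p)
  mono (suc i , inj₁ _) (_ , inj₂ _)     (inj₂ (refl , _)) = inj₁ (ℕ.n<1+n i)
  mono (suc _ , inj₁ _) (suc _ , inj₁ _) (inj₁ (s≤s p))    = inj₁ p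
  mono (suc _ , inj₁ _) (suc _ , inj₁ _) (inj₂ (refl , q)) = inj₂ (refl , q)

ω⊗finOrd≃ω : ∀ c → ωOrd ⊗ finOrd (suc c) ≃ ωOrd
ω⊗finOrd≃ω c = strictMono⇒≃ t f f-inverse mono
  where
  t : ℕ × Fin (suc c) → ℕ
  t (i , j) = F.toℕ j + i * suc c

  f : ℕ → ℕ × Fin (suc c)
  f k = k / suc c , F.fromℕ< (m%n<n k (suc c))

  f-inverse : ∀ k → t (f k) ≡ k
  f-inverse k = trans (cong (_+ (k / suc c) * suc c) (F.toℕ-fromℕ< (m%n<n k (suc c))))
                      (sym (m≡m%n+[m/n]*n k (suc c)))

  mono : StrictlyMonotone (ωOrd ⊗ finOrd (suc c)) ωOrd t
  mono (i , j) (i′ , j′) (inj₁ i<i′) = begin-strict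
    F.toℕ j + i * suc c   <⟨ ℕ.+-monoˡ-< (i * suc c) (F.toℕ<n j) ⟩
    suc i * suc c         ≤⟨ ℕ.*-monoˡ-≤ (suc c) i<i′ ⟩
    i′ * suc c            ≤⟨ ℕ.m≤n+m (i′ * suc c) (F.toℕ j′) ⟩
    F.toℕ j′ + i′ * suc c ∎
    where open ℕ.≤-Reasoning
  mono (i , _) _ (inj₂ (refl , j<j′)) = ℕ.+-monoˡ-< (i * suc c) j<j′

ωpow-suc≃ωpow⊗ω : ∀ n → ωpow (suc n) ≃ ωpow n ⊗ ωOrd
ωpow-suc≃ωpow⊗ω zero = begin
  ωOrd ⊗ finOrd 1  ≃⟨ ω⊗finOrd≃ω 0 ⟩
  ωOrd             ≃⟨ finOrd1-⊗-identityˡ ⟨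
  finOrd 1 ⊗ ωOrd  ∎
  where open ≃-Reasoning
ωpow-suc≃ωpow⊗ω (suc n) = begin
  ωOrd ⊗ ωpow (suc n)        ≃⟨ ⊗-cong ≃-refl (ωpow-suc≃ωpow⊗ω n) ⟩
  ωOrd ⊗ (ωpow n ⊗ ωOrd)     ≃⟨ ⊗-assoc ⟨
  (ωOrd ⊗ ωpow n) ⊗ ωOrd     ∎
  where
  open ≃-Reasoning
  instance _ = ωpow-total n

-- Absorption: A + B = B

Absorbed : LinOrd → LinOrd → Set
Absorbed A B = A ⊕ B ≃ B

absorbed-respˡ : ∀ {A A′ B} → A ≃ A′ → Absorbed A′ B → Absorbed A B
absorbed-respˡ φ h = ≃-trans (⊕-cong φ ≃-refl) h

absorbed-respʳ : ∀ {A B B′} → B ≃ B′ → Absorbed A B → Absorbed A B′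
absorbed-respʳ ψ h = ≃-trans (⊕-cong ≃-refl (≃-sym ψ)) (≃-trans h ψ)

module _ {A B C : LinOrd} {{_ : Total A}} {{_ : Total B}} {{_ : Total C}} where

  absorbed-⊕ˡ : Absorbed A C → Absorbed B C → Absorbed (A ⊕ B) C
  absorbed-⊕ˡ hA hB = ≃-trans ⊕-assoc (≃-trans (⊕-cong ≃-refl hB) hA)

  absorbed-⊕ʳ : Absorbed A B → Absorbed A (B ⊕ C)
  absorbed-⊕ʳ h = ≃-trans (≃-sym ⊕-assoc) (⊕-cong h ≃-refl)

module _ {Y : LinOrd} {{_ : Total Y}} where

  absorbed-ω⊗ : ∀ {A} {{_ : Total A}} → Absorbed A Y → Absorbed A (ωOrd ⊗ Y)
  absorbed-ω⊗ h = absorbed-respʳ ω⊗-unfold (absorbed-⊕ʳ h)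

  finOrd⊗-absorbed-ω⊗ : ∀ k → Absorbed (finOrd k ⊗ Y) (ωOrd ⊗ Y)
  finOrd⊗-absorbed-ω⊗ zero    = finOrd0-⊗-⊕-identityˡ
  finOrd⊗-absorbed-ω⊗ (suc k) =
    absorbed-respˡ (finOrd-suc-⊗ k) (absorbed-⊕ˡ ω⊗-unfold (finOrd⊗-absorbed-ω⊗ k))

cnf-absorbed-ωpow : ∀ m b → Absorbed (cnf m b) (ωpow (suc m))
cnf-absorbed-ωpow zero    b = finOrd⊗-absorbed-ω⊗ (b F.zero)
cnf-absorbed-ωpow (suc m) b =
  absorbed-⊕ˡ (finOrd⊗-absorbed-ω⊗ _) (absorbed-ω⊗ (cnf-absorbed-ωpow m _))
  where instance
    _ = ωpow-total m
    _ = cnf-total m _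

cnf-absorbed-term : ∀ m b c → c ≢ 0 → Absorbed (cnf m b) (term (suc m) c)
cnf-absorbed-term m b zero    c≢0 = ⊥-elim (c≢0 refl)
cnf-absorbed-term m b (suc c) _   =
  absorbed-respʳ (≃-sym (finOrd-suc-⊗ c)) (absorbed-⊕ʳ (cnf-absorbed-ωpow m b))
  where instance
    _ = ωpow-total m
    _ = cnf-total m b

-- The order type of ω ⊗ cnf n a

ω⊗-absorbed : ∀ {A B} {{_ : Total A}} {{_ : Total B}} →
  Absorbed B A → ωOrd ⊗ (A ⊕ B) ≃ ωOrd ⊗ A
ω⊗-absorbed {A} {B} h = begin
  ωOrd ⊗ (A ⊕ B)         ≃⟨ ω⊗-⊕-rotate ⟩
  A ⊕ (ωOrd ⊗ (B ⊕ A))   ≃⟨ ⊕-cong ≃-refl (⊗-cong ≃-refl h) ⟩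
  A ⊕ (ωOrd ⊗ A)         ≃⟨ ω⊗-unfold ⟩
  ωOrd ⊗ A               ∎
  where open ≃-Reasoning

ω⊗term≃ωpow⊗ω : ∀ n c → c ≢ 0 → ωOrd ⊗ term n c ≃ ωpow n ⊗ ωOrd
ω⊗term≃ωpow⊗ω n zero    c≢0 = ⊥-elim (c≢0 refl)
ω⊗term≃ωpow⊗ω n (suc c) _   = begin
  ωOrd ⊗ (finOrd (suc c) ⊗ ωpow n)   ≃⟨ ⊗-assoc ⟨
  (ωOrd ⊗ finOrd (suc c)) ⊗ ωpow n   ≃⟨ ⊗-cong (ω⊗finOrd≃ω c) ≃-refl ⟩
  ωOrd ⊗ ωpow n                      ≃⟨ ωpow-suc≃ωpow⊗ω n ⟩
  ωpow n ⊗ ωOrd                      ∎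
  where
  open ≃-Reasoning
  instance _ = ωpow-total n

ω⊗cnf≃ω⊗leadingTerm : ∀ n a → a (fromℕ n) ≢ 0 →
  ωOrd ⊗ cnf n a ≃ ωOrd ⊗ term n (a (fromℕ n))
ω⊗cnf≃ω⊗leadingTerm zero    a _     = ≃-refl
ω⊗cnf≃ω⊗leadingTerm (suc m) a a≢0 = ω⊗-absorbed (cnf-absorbed-term m _ _ a≢0)
  where instance
    _ = ωpow-total m
    _ = cnf-total m _

-- Condensation

∼F-sym : ∀ {L x y} → ∼F L x y → ∼F L y x
∼F-sym (l , cover) = l , λ z → cover z ∘ Sum.swap

¬all-above-∈ : ∀ N (ns : List ℕ) → ¬ (∀ k → N ℕ.< k → k ∈ ns)
¬all-above-∈ N ns all∈ = ℕ.<⇒≱ (s≤s (ℕ.m≤n+m (max 0 ns) N)) k≤max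
  where
  k≤max : suc (N + max 0 ns) ℕ.≤ max 0 ns
  k≤max = All.lookup (xs≤max 0 ns) (all∈ _ (s≤s (ℕ.m≤m+n N _)))

module _ {M : LinOrd} {{_ : Total M}} where

  inside-fibre : ∀ {m i j z} → (m , i) <[ M ⊗ ωOrd ] z → z <[ M ⊗ ωOrd ] (m , j) →
    proj₁ z ≡ m × proj₂ z ℕ.< j
  inside-fibre (inj₁ p)          (inj₁ q)            = ⊥-elim (<-asym M p q)
  inside-fibre (inj₁ p)          (inj₂ (refl , _))   = ⊥-elim (<-irrefl M p)
  inside-fibre (inj₂ (refl , _)) (inj₁ q)            = ⊥-elim (<-irrefl M q)
  inside-fibre (inj₂ (refl , _)) (inj₂ (refl , k<j)) = refl , k<j

  fibre-∼F : ∀ m i j → ∼F (M ⊗ ωOrd) (m , i) (m , j)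
  fibre-∼F m i j = applyUpTo (m ,_) (i + j) , cover
    where
    cover : ∀ z → Between (M ⊗ ωOrd) (m , i) (m , j) z → z ∈ applyUpTo (m ,_) (i + j)
    cover z (inj₁ (p , q)) with inside-fibre p q
    ... | refl , k<j = ∈-applyUpTo⁺ (m ,_) (ℕ.<-≤-trans k<j (ℕ.m≤n+m j i))
    cover z (inj₂ (p , q)) with inside-fibre p q
    ... | refl , k<i = ∈-applyUpTo⁺ (m ,_) (ℕ.<-≤-trans k<i (ℕ.m≤m+n i j))

  distinct-fibres-¬∼F : ∀ {m m′} i j → m <[ M ] m′ → ¬ ∼F (M ⊗ ωOrd) (m , i) (m′ , j)
  distinct-fibres-¬∼F {m} i j m<m′ (l , cover) = ¬all-above-∈ i (map proj₂ l) λ k i<k →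
    ∈-map⁺ proj₂ (cover (m , k) (inj₁ (inj₂ (refl , i<k) , inj₁ m<m′)))

  ∼F⇒same-fibre : ∀ x y → ∼F (M ⊗ ωOrd) x y → proj₁ x ≡ proj₁ y
  ∼F⇒same-fibre (m , i) (m′ , j) x∼y with compare m m′
  ... | tri< m<m′ _ _ = ⊥-elim (distinct-fibres-¬∼F i j m<m′ x∼y)
  ... | tri≈ _ m≡m′ _ = m≡m′
  ... | tri> _ _ m′<m = ⊥-elim (distinct-fibres-¬∼F j i m′<m (∼F-sym {M ⊗ ωOrd} x∼y))

  ⊗ω-condensation : CondensationIs (M ⊗ ωOrd) M
  ⊗ω-condensation = proj₁ , (λ m → (m , 0) , refl)
    , (λ x y → mk⇔ (same-fibre⇒∼F x y) (∼F⇒same-fibre x y))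
    , (λ x y → mk⇔ (λ p → inj₁ p , distinct-fibres-¬∼F _ _ p) (<∧¬∼F⇒< x y))
    where
    same-fibre⇒∼F : ∀ x y → proj₁ x ≡ proj₁ y → ∼F (M ⊗ ωOrd) x y
    same-fibre⇒∼F (m , i) (_ , j) refl = fibre-∼F m i j

    <∧¬∼F⇒< : ∀ x y → x <[ M ⊗ ωOrd ] y × ¬ ∼F (M ⊗ ωOrd) x y → proj₁ x <[ M ] proj₁ y
    <∧¬∼F⇒< _       _       (inj₁ p , _)          = p
    <∧¬∼F⇒< (m , i) (_ , j) (inj₂ (refl , _) , ¬∼F) = ⊥-elim (¬∼F (fibre-∼F m i j))

module _ {L L′ : LinOrd} (φ : L ≃ L′) where

  <-≃ : ∀ {x y} → x <[ L ] y ⇔ to φ x <[ L′ ] to φ y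
  <-≃ {x} {y} = mk⇔ (to-mono φ x y) (subst₂ (lt L) (from∘to φ x) (from∘to φ y) ∘ from-mono φ _ _)

  ∼F-reflect : ∀ {x y} → ∼F L′ (to φ x) (to φ y) → ∼F L x y
  ∼F-reflect (l , cover) = map (from φ) l , λ z between →
    subst (_∈ map (from φ) l) (from∘to φ z) (∈-map⁺ (from φ) (cover (to φ z) (Between-≃ between)))
    where
    Between-≃ : ∀ {x y z} → Between L x y z → Between L′ (to φ x) (to φ y) (to φ z)
    Between-≃ = Sum.map (Product.map (to-mono φ _ _) (to-mono φ _ _))
                        (Product.map (to-mono φ _ _) (to-mono φ _ _))

∼F-≃ : ∀ {L L′} (φ : L ≃ L′) {x y} → ∼F L x y ⇔ ∼F L′ (to φ x) (to φ y)
∼F-≃ {L} φ {x} {y} = mk⇔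
  (∼F-reflect (≃-sym φ) ∘ subst₂ (∼F L) (sym (from∘to φ x)) (sym (from∘to φ y)))
  (∼F-reflect φ)

CondensationIs-resp-≃ : ∀ {L L′ M} → L ≃ L′ → CondensationIs L′ M → CondensationIs L M
CondensationIs-resp-≃ φ (f , surjective , kernel , order) = f ∘ to φ
  , (λ m → let (x , fx≡m) = surjective m in from φ x , trans (cong f (to∘from φ x)) fx≡m)
  , (λ x y → ⇔.trans (kernel (to φ x) (to φ y)) (⇔.sym (∼F-≃ φ)))
  , (λ x y → ⇔.trans (order (to φ x) (to φ y)) (⇔.sym (<-≃ φ ×-⇔ ¬-cong-⇔ (∼F-≃ φ))))

mainTheorem5 : (n : ℕ) (a : Fin (suc n) → ℕ) → a (fromℕ n) ≢ 0 →
    CondensationIs (ωOrd ⊗ cnf n a) (ωpow n)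
mainTheorem5 n a a≢0 = CondensationIs-resp-≃ {M = ωpow n} ω⊗cnf≃ωpow⊗ω ⊗ω-condensation
  where
  instance _ = ωpow-total n

  ω⊗cnf≃ωpow⊗ω : ωOrd ⊗ cnf n a ≃ ωpow n ⊗ ωOrd
  ω⊗cnf≃ωpow⊗ω = ≃-trans (ω⊗cnf≃ω⊗leadingTerm n a a≢0) (ω⊗term≃ωpow⊗ω n _ a≢0)
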